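{- $M^L(6)\leq 15$, where $M^L(6)$ denotes the minimum cardinality of a local identifying code in the binary $6$-dimensional hypercube.
   Context: The binary $n$-dimensional hypercube is the graph with vertex set $\{0,1\}^n$ in which two binary words are adjacent iff their Hamming distance is $1$. For a vertex $u$, $N[u]$ is its closed neighbourhood, and for a code (nonempty vertex subset) $C$, $I_C(u)=N[u]\cap C$. A code $C$ is a covering code if $I_C(u)\neq\emptyset$ for every vertex $u$. A code $C$ is a local identifying code if it is a covering code and $I_C(u)\neq I_C(v)$ for every pair of adjacent vertices $u,v$. -}

module Defs where

open import Data.Nat using (ℕ; zero; suc; _+_; _≤_)
open import Data.Bool using (Bool; if_then_else_)
open import Data.Bool.Properties using () renaming (_≟_ to _≟B_)
open import Data.Vec using (Vec; []; _∷_)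
open import Data.List using (List; []; length)
open import Data.List.Membership.Propositional using (_∈_)
open import Data.List.Relation.Unary.Unique.Propositional using (Unique)
open import Data.Product using (Σ; ∃; _×_)
open import Relation.Nullary using (¬_; does)
open import Relation.Binary.PropositionalEquality using (_≡_; _≢_)

Word : ℕ → Set
Word n = Vec Bool n

hamming : ∀ {n} → Word n → Word n → ℕ
hamming [] [] = 0
hamming (x ∷ xs) (y ∷ ys) = (if does (x ≟B y) then 0 else 1) + hamming xs ys

Adjacent : ∀ {n} → Word n → Word n → Set
Adjacent u v = hamming u v ≡ 1

InClosedNbhd : ∀ {n} → Word n → Word n → Set
InClosedNbhd u w = hamming u w ≤ 1

-- A code is a nonempty set of vertices, represented by a duplicate-free list.
-- w ∈ I_C(u)  iff  w ∈ N[u] ∩ C.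
InI : ∀ {n} → List (Word n) → Word n → Word n → Set
InI C u w = InClosedNbhd u w × w ∈ C

IsCovering : ∀ {n} → List (Word n) → Set
IsCovering {n} C = (u : Word n) → ∃ λ w → InI C u w

IDiffer : ∀ {n} → List (Word n) → Word n → Word n → Set
IDiffer {n} C u v = ¬ ((w : Word n) → (InI C u w → InI C v w) × (InI C v w → InI C u w))

IsLocalIdentifying : ∀ {n} → List (Word n) → Set
IsLocalIdentifying {n} C =
  C ≢ [] × IsCovering C × ((u v : Word n) → Adjacent u v → IDiffer C u v)

MLAtMost : ℕ → ℕ → Set
MLAtMost n k = Σ (List (Word n)) λ C → Unique C × IsLocalIdentifying C × length C ≤ k

{-# OPTIONS --safe #-}
module Submission where

-- Covering and local identification are finite
-- properties of the 64 vertices and their edges; quantified over an explicit enumeration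
-- of all words they become decidable, and are decided by evaluation.

open import Defs
open import Data.Nat using (zero; suc; _≤?_; _≟_)
open import Data.Nat.Properties using (≤-refl)
open import Data.Bool using (true; false)
open import Data.Bool.Properties using () renaming (_≟_ to _≟B_)
open import Data.Vec using ([]; _∷_)
open import Data.Vec.Properties using (≡-dec)
open import Data.List using (List; []; _∷_; map; _++_)
open import Data.List.Membership.Propositional using (_∈_; find)
open import Data.List.Membership.Propositional.Properties using (∈-++⁺ˡ; ∈-++⁺ʳ; ∈-map⁺)
open import Data.List.Relation.Unary.Any using (Any; here; any?)
open import Data.List.Relation.Unary.All using (All; all?; lookup)
open import Data.List.Relation.Unary.Unique.DecPropositional using (unique?)
open import Data.Product using (∃; _×_; _,_; proj₁; proj₂)
open import Data.Sum using (_⊎_; inj₁; inj₂)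
open import Relation.Nullary using (¬_; Dec)
open import Relation.Nullary.Decidable using (from-yes; _×-dec_; _⊎-dec_; _→-dec_; ¬?)
open import Relation.Unary using (Pred)
open import Relation.Binary.PropositionalEquality using (refl)

allWords : ∀ n → List (Word n)
allWords zero    = [] ∷ []
allWords (suc n) = map (true ∷_) (allWords n) ++ map (false ∷_) (allWords n)

∈-allWords : ∀ {n} (u : Word n) → u ∈ allWords n
∈-allWords []                  = here refl
∈-allWords {suc n} (true ∷ u)  = ∈-++⁺ˡ (∈-map⁺ (true ∷_) (∈-allWords u))
∈-allWords {suc n} (false ∷ u) =
  ∈-++⁺ʳ (map (true ∷_) (allWords n)) (∈-map⁺ (false ∷_) (∈-allWords u))

∀-fromAllWords : ∀ {n p} {P : Pred (Word n) p} → All P (allWords n) → ∀ u → P u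
∀-fromAllWords all-P u = lookup all-P (∈-allWords u)

inClosedNbhd? : ∀ {n} (u w : Word n) → Dec (InClosedNbhd u w)
inClosedNbhd? u w = hamming u w ≤? 1

Covered : ∀ {n} → List (Word n) → Word n → Set
Covered C u = Any (InClosedNbhd u) C

covered? : ∀ {n} (C : List (Word n)) (u : Word n) → Dec (Covered C u)
covered? C u = any? (inClosedNbhd? u) C

covered⇒∃InI : ∀ {n} {C : List (Word n)} {u : Word n} → Covered C u → ∃ (InI C u)
covered⇒∃InI covered with find covered
... | w , w∈C , u~w = w , u~w , w∈C

isCovering : ∀ {n} {C : List (Word n)} → All (Covered C) (allWords n) → IsCovering C
isCovering all-covered u = covered⇒∃InI {u = u} (∀-fromAllWords all-covered u)

Separates : ∀ {n} → Word n → Word n → Word n → Set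
Separates u v w = InClosedNbhd u w × ¬ InClosedNbhd v w

separates? : ∀ {n} (u v w : Word n) → Dec (Separates u v w)
separates? u v w = inClosedNbhd? u w ×-dec ¬? (inClosedNbhd? v w)

Separated : ∀ {n} → List (Word n) → Word n → Word n → Set
Separated C u v = Any (λ w → Separates u v w ⊎ Separates v u w) C

separated? : ∀ {n} (C : List (Word n)) (u v : Word n) → Dec (Separated C u v)
separated? C u v = any? (λ w → separates? u v w ⊎-dec separates? v u w) C

separated⇒IDiffer : ∀ {n} {C : List (Word n)} {u v : Word n} → Separated C u v → IDiffer C u v
separated⇒IDiffer separated same-I with find separated
... | w , w∈C , inj₁ (u~w , v≁w) = v≁w (proj₁ (proj₁ (same-I w) (u~w , w∈C)))
... | w , w∈C , inj₂ (v~w , u≁w) = u≁w (proj₁ (proj₂ (same-I w) (v~w , w∈C)))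

LocallySeparating : ∀ {n} → List (Word n) → Set
LocallySeparating {n} C =
  All (λ u → All (λ v → Adjacent u v → Separated C u v) (allWords n)) (allWords n)

locallySeparating? : ∀ {n} (C : List (Word n)) → Dec (LocallySeparating C)
locallySeparating? {n} C =
  all? (λ u → all? (λ v → (hamming u v ≟ 1) →-dec separated? C u v) (allWords n)) (allWords n)

adjacent⇒IDiffer : ∀ {n} {C : List (Word n)} → LocallySeparating C →
                   (u v : Word n) → Adjacent u v → IDiffer C u v
adjacent⇒IDiffer sep u v u~v = separated⇒IDiffer {u = u} {v = v} (∀-fromAllWords (∀-fromAllWords sep u) v u~v)

pattern O = false
pattern I = true

code₁₅ : List (Word 6)
code₁₅ =
  (O ∷ O ∷ I ∷ O ∷ O ∷ I ∷ []) ∷ (O ∷ O ∷ I ∷ O ∷ I ∷ O ∷ []) ∷ (O ∷ O ∷ I ∷ I ∷ O ∷ O ∷ []) ∷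
  (O ∷ O ∷ I ∷ I ∷ O ∷ I ∷ []) ∷ (O ∷ I ∷ O ∷ O ∷ I ∷ I ∷ []) ∷ (O ∷ I ∷ I ∷ O ∷ I ∷ O ∷ []) ∷
  (O ∷ I ∷ I ∷ O ∷ I ∷ I ∷ []) ∷ (I ∷ O ∷ O ∷ O ∷ O ∷ O ∷ []) ∷ (I ∷ O ∷ O ∷ I ∷ I ∷ O ∷ []) ∷
  (I ∷ O ∷ O ∷ I ∷ I ∷ I ∷ []) ∷ (I ∷ I ∷ O ∷ O ∷ O ∷ O ∷ []) ∷ (I ∷ I ∷ O ∷ I ∷ O ∷ O ∷ []) ∷
  (I ∷ I ∷ O ∷ I ∷ O ∷ I ∷ []) ∷ (I ∷ I ∷ O ∷ I ∷ I ∷ O ∷ []) ∷ (I ∷ I ∷ I ∷ O ∷ I ∷ I ∷ []) ∷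
  []

mainTheorem6 : MLAtMost 6 15
mainTheorem6 =
  code₁₅ ,
  from-yes (unique? (≡-dec _≟B_) code₁₅) ,
  ( (λ ())
  , isCovering (from-yes (all? (covered? code₁₅) (allWords 6)))
  , adjacent⇒IDiffer (from-yes (locallySeparating? code₁₅)) ) ,
  ≤-refl
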